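{- Let $m\ge 2$, $n\ge 2$, let $S_m$ be the star $K_{1,m}$ and $P_n$ the path on $n$ vertices, and let $\Delta$ be the maximum degree of $S_m\times P_n$. Then $$\chi''_{\Sigma}(S_m\times P_n)=\begin{cases}\Delta+1 & \text{if } n=3,\\ \Delta+2 & \text{if } n=2 \text{ or } n\ge 4.\end{cases}$$
   Context: All graphs are finite and simple. A proper total $k$-coloring of a graph $G$ assigns to every vertex and every edge a color from $\{1,\dots,k\}$ such that adjacent vertices receive different colors, edges sharing an endpoint receive different colors, and no edge receives the same color as either of its endpoints. For such a coloring $c$ and a vertex $v$, let $f(v)=c(v)+\sum_{e\ni v} c(e)$. The coloring distinguishes adjacent vertices by sums if $f(u)\neq f(v)$ for every edge $uv$. $\chi''_{\Sigma}(G)$ denotes the smallest $k$ such that $G$ has a proper total $k$-coloring distinguishing adjacent vertices by sums. The product $G_1\times G_2$ is the Cartesian product: vertex set $V(G_1)\times V(G_2)$, with $(u_1,u_2)$ adjacent to $(v_1,v_2)$ iff either $u_1=v_1$ and $u_2v_2\in E(G_2)$, or $u_1v_1\in E(G_1)$ and $u_2=v_2$. The star $S_m$ has a central vertex adjacent to $m$ leaves (so $S_2=P_3$). -}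

module Defs where

open import Data.Nat using (ℕ; zero; suc; _+_; _*_; _≤_; _<_; _⊔_)
open import Data.Bool using (Bool; true; false; if_then_else_; _∧_; _∨_)
open import Data.Fin using (Fin; toℕ; remQuot)
open import Data.Fin.Properties using () renaming (_≟_ to _≟ᶠ_)
open import Data.List using (List; map; foldr; allFin; filter)
open import Data.Nat.ListAction using (sum)
open import Data.List using (length)
open import Data.Product using (Σ; _×_; _,_; proj₁; proj₂)
open import Relation.Binary.PropositionalEquality using (_≡_; _≢_)
open import Relation.Nullary.Decidable using (⌊_⌋)
open import Data.Nat using () renaming (_≟_ to _≟ℕ_)

record Graph : Set where
  field
    N     : ℕ
    adj   : Fin N → Fin N → Bool
    adj-sym   : ∀ u v → adj u v ≡ adj v u
    adj-irrefl : ∀ v → adj v v ≡ false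
open Graph public

degree : (G : Graph) → Fin (N G) → ℕ
degree G v = length (filter (λ u → adj G v u ≡? true) (allFin (N G)))
  where
    open import Data.Bool.Properties using () renaming (_≟_ to _≡?_)

maxDegree : Graph → ℕ
maxDegree G = foldr _⊔_ 0 (map (degree G) (allFin (N G)))

-- A total colouring: vertex colours and edge colours (edge uv gets colour
-- ecol u v, which is required to be symmetric on edges).
record TotalColouring (G : Graph) : Set where
  field
    vcol : Fin (N G) → ℕ
    ecol : Fin (N G) → Fin (N G) → ℕ
open TotalColouring public

weight : (G : Graph) → TotalColouring G → Fin (N G) → ℕ
weight G c v =
  vcol c v + sum (map (λ u → if adj G v u then ecol c v u else 0) (allFin (N G)))

IsNSDTotalColouring : (G : Graph) → ℕ → TotalColouring G → Set
IsNSDTotalColouring G k c =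
    (∀ v → 1 ≤ vcol c v × vcol c v ≤ k)
  × (∀ u v → adj G u v ≡ true → 1 ≤ ecol c u v × ecol c u v ≤ k)
  × (∀ u v → adj G u v ≡ true → ecol c u v ≡ ecol c v u)
  × (∀ u v → adj G u v ≡ true → vcol c u ≢ vcol c v)
  × (∀ u v w → adj G u v ≡ true → adj G u w ≡ true → v ≢ w → ecol c u v ≢ ecol c u w)
  × (∀ u v → adj G u v ≡ true → ecol c u v ≢ vcol c u)
  × (∀ u v → adj G u v ≡ true → weight G c u ≢ weight G c v)

HasNSDTotalColouring : Graph → ℕ → Set
HasNSDTotalColouring G k = Σ (TotalColouring G) (IsNSDTotalColouring G k)

NSDTotalChromaticNumberIs : Graph → ℕ → Set
NSDTotalChromaticNumberIs G k =
  HasNSDTotalColouring G k × (∀ j → j < k → HasNSDTotalColouring G j → Data.Empty.⊥)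
  where import Data.Empty

eqFin : ∀ {n} → Fin n → Fin n → Bool
eqFin i j = ⌊ i ≟ᶠ j ⌋

eqℕ : ℕ → ℕ → Bool
eqℕ a b = ⌊ a ≟ℕ b ⌋

-- Star S_m = K_{1,m}: vertex 0 is the centre, vertices 1..m are leaves.
starAdj : ∀ m → Fin (suc m) → Fin (suc m) → Bool
starAdj m i j = (eqℕ (toℕ i) 0 ∧ Data.Bool.not (eqℕ (toℕ j) 0))
              ∨ (eqℕ (toℕ j) 0 ∧ Data.Bool.not (eqℕ (toℕ i) 0))
  where import Data.Bool

pathAdj : ∀ n → Fin n → Fin n → Bool
pathAdj n i j = eqℕ (toℕ j) (suc (toℕ i)) ∨ eqℕ (toℕ i) (suc (toℕ j))

private
  open import Data.Bool.Properties using (∨-comm; ∧-inverseʳ)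
  open import Relation.Binary.PropositionalEquality using (refl; cong; cong₂; trans; sym)
  open import Relation.Nullary using (yes; no)
  open import Data.Nat.Properties using (m≢1+m+n; +-identityʳ)
  open import Relation.Nullary.Decidable using (dec-false)

  eqℕ-sym : ∀ a b → eqℕ a b ≡ eqℕ b a
  eqℕ-sym a b with a ≟ℕ b | b ≟ℕ a
  ... | yes _ | yes _ = refl
  ... | no _  | no _  = refl
  ... | yes p | no q  = Data.Empty.⊥-elim (q (sym p)) where import Data.Empty
  ... | no p  | yes q = Data.Empty.⊥-elim (p (sym q)) where import Data.Empty

  eqFin-sym : ∀ {n} (a b : Fin n) → eqFin a b ≡ eqFin b a
  eqFin-sym a b with a ≟ᶠ b | b ≟ᶠ a
  ... | yes _ | yes _ = refl
  ... | no _  | no _  = refl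
  ... | yes p | no q  = Data.Empty.⊥-elim (q (sym p)) where import Data.Empty
  ... | no p  | yes q = Data.Empty.⊥-elim (p (sym q)) where import Data.Empty

  eqFin-refl : ∀ {n} (a : Fin n) → eqFin a a ≡ true
  eqFin-refl a with a ≟ᶠ a
  ... | yes _ = refl
  ... | no q = Data.Empty.⊥-elim (q refl) where import Data.Empty

  eqℕ-suc : ∀ a → eqℕ a (suc a) ≡ false
  eqℕ-suc a with a ≟ℕ suc a
  ... | yes e = Data.Empty.⊥-elim (m≢1+m+n a {0} (trans e (cong suc (sym (+-identityʳ a))))) where import Data.Empty
  ... | no _ = refl

Star : ℕ → Graph
Star m = record
  { N = suc m ; adj = starAdj m
  ; adj-sym = λ i j → ∨-comm (eqℕ (toℕ i) 0 ∧ Data.Bool.not (eqℕ (toℕ j) 0)) _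
  ; adj-irrefl = λ i → lem (eqℕ (toℕ i) 0) }
  where
    lem : ∀ b → (b ∧ Data.Bool.not b) ∨ (b ∧ Data.Bool.not b) ≡ false
    lem false = refl
    lem true = refl
    import Data.Bool

Path : ℕ → Graph
Path n = record
  { N = n ; adj = pathAdj n
  ; adj-sym = λ i j → ∨-comm (eqℕ (toℕ j) (suc (toℕ i))) _
  ; adj-irrefl = λ i → cong₂ _∨_ (eqℕ-suc (toℕ i)) (eqℕ-suc (toℕ i)) }

-- Cartesian product G₁ × G₂; vertex (a , b) is encoded by combine a b,
-- decoded by remQuot. (a₁,a₂) ~ (b₁,b₂) iff (a₁ = b₁ and a₂b₂ ∈ E(G₂))
-- or (a₁b₁ ∈ E(G₁) and a₂ = b₂).
pairAdj : (G₁ G₂ : Graph) → Fin (N G₁) × Fin (N G₂) → Fin (N G₁) × Fin (N G₂) → Bool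
pairAdj G₁ G₂ (a₁ , a₂) (b₁ , b₂) =
  (eqFin a₁ b₁ ∧ adj G₂ a₂ b₂) ∨ (adj G₁ a₁ b₁ ∧ eqFin a₂ b₂)

productAdj : (G₁ G₂ : Graph) → Fin (N G₁ * N G₂) → Fin (N G₁ * N G₂) → Bool
productAdj G₁ G₂ x y = pairAdj G₁ G₂ (remQuot (N G₂) x) (remQuot (N G₂) y)

private
  pairSym : (G₁ G₂ : Graph) → ∀ p q → pairAdj G₁ G₂ p q ≡ pairAdj G₁ G₂ q p
  pairSym G₁ G₂ (a₁ , a₂) (b₁ , b₂) =
      cong₂ _∨_ (cong₂ _∧_ (eqFin-sym a₁ b₁) (Graph.adj-sym G₂ a₂ b₂))
                (cong₂ _∧_ (Graph.adj-sym G₁ a₁ b₁) (eqFin-sym a₂ b₂))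
  pairIrr : (G₁ G₂ : Graph) → ∀ p → pairAdj G₁ G₂ p p ≡ false
  pairIrr G₁ G₂ (a₁ , a₂) rewrite eqFin-refl a₁ | eqFin-refl a₂
                          | Graph.adj-irrefl G₁ a₁ | Graph.adj-irrefl G₂ a₂ = refl

_□_ : Graph → Graph → Graph
G₁ □ G₂ = record
  { N = N G₁ * N G₂ ; adj = productAdj G₁ G₂
  ; adj-sym = λ x y → pairSym G₁ G₂ (remQuot (N G₂) x) (remQuot (N G₂) y)
  ; adj-irrefl = λ x → pairIrr G₁ G₂ (remQuot (N G₂) x) }

-- At a vertex x the colour of x and those of its edges are deg x + 1 distinct colours, so at least
-- Δ + 1 colours are needed; with exactly deg x + 1 colours they are all of 1, …, k, so the weight
-- of x is forced. Two adjacent vertices of maximum degree therefore need Δ + 2 colours; for n = 2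
-- and n ≥ 4 such a pair lies on the copy of P_n over the centre of the star, whereas for n = 3 the
-- only vertex of degree Δ is the middle of that copy.
-- For the upper bounds, colour the copy of P_n over the centre and all copies over the leaves by
-- two periodic total colourings with a colours (a = 3 for n ≤ 3, a = 4 for n ≥ 4), and give the
-- m edges of each star the colours a + 1, …, a + m. A centre vertex then collects all m of these,
-- which makes it heavier than each of its leaf neighbours; m + a is Δ + 1 or Δ + 2 as required.

module Submission where

open import Defs
open import Data.Nat using (ℕ; zero; suc; _+_; _*_; _≤_; _<_; z≤n; s≤s; s≤s⁻¹; _≡ᵇ_; _<ᵇ_; _⊓_; _⊔_; _≤?_)
open import Data.Nat.Properties
open import Data.Nat.ListAction using (sum)
open import Data.Nat.ListAction.Properties using (sum-++)
open import Data.Bool using (Bool; true; false; if_then_else_; _∧_; _∨_; not; T)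
open import Data.Bool.Properties using (∧-zeroʳ; ∨-identityʳ) renaming (_≟_ to _≟ᵇ_)
open import Data.Fin using (Fin; toℕ; zero; suc; _↑ˡ_; _↑ʳ_; combine; remQuot; fromℕ<)
open import Data.Fin.Properties
  using (toℕ<n; toℕ-fromℕ<; remQuot-combine; combine-remQuot; toℕ-injective) renaming (_≟_ to _≟ᶠ_)
open import Data.List using (List; []; _∷_; map; filter; allFin; length; _++_; foldr; tabulate)
open import Data.List.Properties using (length-map; length-++)
open import Data.List.Membership.Propositional using (_∈_)
open import Data.List.Membership.Propositional.Properties using (∈-∃++; ∈-++⁻; ∈-++⁺ˡ; ∈-++⁺ʳ; ∈-allFin)
open import Data.List.Relation.Unary.All as All using (All; []; _∷_)
import Data.List.Relation.Unary.All.Properties as All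
open import Data.List.Relation.Unary.AllPairs using ([]; _∷_)
open import Data.List.Relation.Unary.Any using (here; there)
open import Data.List.Relation.Unary.Unique.Propositional using (Unique)
import Data.List.Relation.Unary.Unique.Propositional.Properties as Unique
open import Data.Product using (_×_; _,_; proj₁; proj₂; uncurry)
open import Data.Sum using (inj₁; inj₂)
open import Data.Empty using (⊥; ⊥-elim)
open import Relation.Nullary using (yes; no)
open import Relation.Nullary.Decidable using (True; toWitness; T?; ⌊_⌋; ⌊⌋-map′)
open import Relation.Binary.PropositionalEquality
open import Function using (id)
open import Algebra.Properties.CommutativeSemigroup +-commutativeSemigroup using (x∙yz≈y∙xz; interchange)

palette : ℕ → List ℕ
palette zero = []
palette (suc k) = suc k ∷ palette k

length-palette : ∀ k → length (palette k) ≡ k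
length-palette zero = refl
length-palette (suc k) = cong suc (length-palette k)

∈-palette : ∀ {k x} → 1 ≤ x → x ≤ k → x ∈ palette k
∈-palette {zero} 1≤x x≤0 = ⊥-elim (<⇒≱ 1≤x x≤0)
∈-palette {suc k} {x} 1≤x x≤k with x ≟ suc k
... | yes refl = here refl
... | no x≢k = there (∈-palette 1≤x (s≤s⁻¹ (≤∧≢⇒< x≤k x≢k)))

private
  All-∈-remove : ∀ {x : ℕ} (ys zs : List ℕ) {xs} →
                 All (x ≢_) xs → All (_∈ ys ++ x ∷ zs) xs → All (_∈ ys ++ zs) xs
  All-∈-remove ys zs [] [] = []
  All-∈-remove ys zs (x≢v ∷ ≢s) (v∈ ∷ ∈s) = remove v∈ (≢-sym x≢v) ∷ All-∈-remove ys zs ≢s ∈s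
    where
    remove : ∀ {x v} → v ∈ ys ++ x ∷ zs → v ≢ x → v ∈ ys ++ zs
    remove v∈ v≢x with ∈-++⁻ ys v∈
    ... | inj₁ v∈ys = ∈-++⁺ˡ v∈ys
    ... | inj₂ (here v≡x) = ⊥-elim (v≢x v≡x)
    ... | inj₂ (there v∈zs) = ∈-++⁺ʳ ys v∈zs

  length-++-∷ : ∀ x (ys zs : List ℕ) → length (ys ++ x ∷ zs) ≡ suc (length (ys ++ zs))
  length-++-∷ x ys zs = begin
    length (ys ++ x ∷ zs)       ≡⟨ length-++ ys ⟩
    length ys + suc (length zs) ≡⟨ +-suc (length ys) (length zs) ⟩
    suc (length ys + length zs) ≡⟨ cong suc (length-++ ys) ⟨
    suc (length (ys ++ zs))     ∎
    where open ≡-Reasoning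

  sum-++-∷ : ∀ x (ys zs : List ℕ) → sum (ys ++ x ∷ zs) ≡ x + sum (ys ++ zs)
  sum-++-∷ x ys zs = begin
    sum (ys ++ x ∷ zs)       ≡⟨ sum-++ ys (x ∷ zs) ⟩
    sum ys + (x + sum zs)    ≡⟨ x∙yz≈y∙xz (sum ys) x (sum zs) ⟩
    x + (sum ys + sum zs)    ≡⟨ cong (x +_) (sum-++ ys zs) ⟨
    x + sum (ys ++ zs)       ∎
    where open ≡-Reasoning

length-≤-unique : ∀ {xs ys : List ℕ} → Unique xs → All (_∈ ys) xs → length xs ≤ length ys
length-≤-unique {[]} _ _ = z≤n
length-≤-unique {x ∷ xs} (x∉xs ∷ xs!) (x∈ ∷ xs⊆) with ∈-∃++ x∈
... | ys , zs , refl = subst (suc (length xs) ≤_) (sym (length-++-∷ x ys zs))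
        (s≤s (length-≤-unique xs! (All-∈-remove ys zs x∉xs xs⊆)))

sum-unique-≡ : ∀ {xs ys : List ℕ} → Unique xs → All (_∈ ys) xs → length ys ≤ length xs → sum xs ≡ sum ys
sum-unique-≡ {[]} {[]} _ _ _ = refl
sum-unique-≡ {x ∷ xs} (x∉xs ∷ xs!) (x∈ ∷ xs⊆) ys≤xs with ∈-∃++ x∈
... | ys , zs , refl = trans
        (cong (x +_) (sum-unique-≡ xs! (All-∈-remove ys zs x∉xs xs⊆)
           (s≤s⁻¹ (subst (_≤ suc (length xs)) (length-++-∷ x ys zs) ys≤xs))))
        (sym (sum-++-∷ x ys zs))

unique-map : ∀ {A : Set} {P : A → Set} (f : A → ℕ) → (∀ {u w} → P u → P w → u ≢ w → f u ≢ f w) →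
             ∀ {xs} → All P xs → Unique xs → Unique (map f xs)
unique-map f f-inj [] [] = []
unique-map f f-inj (pu ∷ ps) (u∉us ∷ us!) =
  All.map⁺ (All.zipWith (λ (pw , u≢w) → f-inj pu pw u≢w) (ps , u∉us)) ∷ unique-map f f-inj ps us!

sum-map-if : ∀ {A : Set} (P : A → Bool) (f : A → ℕ) xs →
             sum (map (λ y → if P y then f y else 0) xs) ≡ sum (map f (filter (λ y → P y ≟ᵇ true) xs))
sum-map-if P f [] = refl
sum-map-if P f (y ∷ xs) with P y
... | true = cong (f y +_) (sum-map-if P f xs)
... | false = sum-map-if P f xs

-- Lower bounds

module _ (G : Graph) where

  neighbours : Fin (N G) → List (Fin (N G))
  neighbours x = filter (λ u → adj G x u ≟ᵇ true) (allFin (N G))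

  coloursAt : TotalColouring G → Fin (N G) → List ℕ
  coloursAt c x = vcol c x ∷ map (ecol c x) (neighbours x)

  length-coloursAt : ∀ c x → length (coloursAt c x) ≡ suc (degree G x)
  length-coloursAt c x = cong suc (length-map (ecol c x) (neighbours x))

  sum-coloursAt : ∀ c x → sum (coloursAt c x) ≡ weight G c x
  sum-coloursAt c x = cong (vcol c x +_) (sym (sum-map-if (adj G x) (ecol c x) (allFin (N G))))

  module _ {k : ℕ} {c : TotalColouring G} (P : IsNSDTotalColouring G k c) (x : Fin (N G)) where

    private
      adjacent-neighbours : All (λ u → adj G x u ≡ true) (neighbours x)
      adjacent-neighbours = All.all-filter (λ u → adj G x u ≟ᵇ true) (allFin (N G))

    unique-coloursAt : Unique (coloursAt c x)
    unique-coloursAt =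
      let (_ , _ , _ , _ , edges-proper , edge≢vertex , _) = P in
      All.map⁺ (All.map (λ x~u → ≢-sym (edge≢vertex x _ x~u)) adjacent-neighbours)
      ∷ unique-map (ecol c x) (edges-proper x _ _) adjacent-neighbours
          (Unique.filter⁺ (λ u → adj G x u ≟ᵇ true) (Unique.allFin⁺ (N G)))

    coloursAt⊆palette : All (_∈ palette k) (coloursAt c x)
    coloursAt⊆palette =
      let (vertex-range , edge-range , _) = P in
      uncurry ∈-palette (vertex-range x)
      ∷ All.map⁺ (All.map (λ x~u → uncurry ∈-palette (edge-range x _ x~u)) adjacent-neighbours)

    suc-degree≤colours : suc (degree G x) ≤ k
    suc-degree≤colours = subst₂ _≤_ (length-coloursAt c x) (length-palette k)
      (length-≤-unique unique-coloursAt coloursAt⊆palette)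

    weight-saturated : k ≤ suc (degree G x) → weight G c x ≡ sum (palette k)
    weight-saturated k≤ = trans (sym (sum-coloursAt c x))
      (sum-unique-≡ unique-coloursAt coloursAt⊆palette
        (subst₂ _≤_ (sym (length-palette k)) (sym (length-coloursAt c x)) k≤))

  no-colouring-≤-degree : ∀ x j → j ≤ degree G x → HasNSDTotalColouring G j → ⊥
  no-colouring-≤-degree x j j≤d (c , P) = <⇒≱ (s≤s j≤d) (suc-degree≤colours P x)

  no-colouring-≤-suc-degree : ∀ x y → adj G x y ≡ true → degree G x ≡ degree G y →
                              ∀ j → j ≤ suc (degree G x) → HasNSDTotalColouring G j → ⊥
  no-colouring-≤-suc-degree x y x~y dx≡dy j j≤ (c , P@(_ , _ , _ , _ , _ , _ , weights-differ)) =
    weights-differ x y x~y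
      (trans (weight-saturated P x j≤) (sym (weight-saturated P y (subst (λ d → j ≤ suc d) dx≡dy j≤))))

  maxDegree-≡ : ∀ D → (∀ x → degree G x ≤ D) → ∀ x₀ → degree G x₀ ≡ D → maxDegree G ≡ D
  maxDegree-≡ D bounded x₀ attained = ≤-antisym (foldr-⊔-≤ (allFin (N G)))
    (subst (_≤ maxDegree G) attained (≤-foldr-⊔ (allFin (N G)) (∈-allFin x₀)))
    where
    foldr-⊔-≤ : ∀ xs → foldr _⊔_ 0 (map (degree G) xs) ≤ D
    foldr-⊔-≤ [] = z≤n
    foldr-⊔-≤ (x ∷ xs) = ⊔-lub (bounded x) (foldr-⊔-≤ xs)
    ≤-foldr-⊔ : ∀ xs {x} → x ∈ xs → degree G x ≤ foldr _⊔_ 0 (map (degree G) xs)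
    ≤-foldr-⊔ (x ∷ xs) (here refl) = m≤m⊔n (degree G x) _
    ≤-foldr-⊔ (y ∷ xs) (there x∈xs) = ≤-trans (≤-foldr-⊔ xs x∈xs) (m≤n⊔m (degree G y) _)

sumFin : ∀ n → (Fin n → ℕ) → ℕ
sumFin zero f = 0
sumFin (suc n) f = f zero + sumFin n (λ i → f (suc i))

sumBelow : ℕ → (ℕ → ℕ) → ℕ
sumBelow zero f = 0
sumBelow (suc n) f = f 0 + sumBelow n (λ i → f (suc i))

sum-map-tabulate : ∀ {A : Set} n (g : Fin n → A) (f : A → ℕ) →
                   sum (map f (tabulate g)) ≡ sumFin n (λ i → f (g i))
sum-map-tabulate zero g f = refl
sum-map-tabulate (suc n) g f = cong (f (g zero) +_) (sum-map-tabulate n (λ i → g (suc i)) f)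

sumFin-cong : ∀ n {f g : Fin n → ℕ} → f ≗ g → sumFin n f ≡ sumFin n g
sumFin-cong zero f≗g = refl
sumFin-cong (suc n) f≗g = cong₂ _+_ (f≗g zero) (sumFin-cong n (λ i → f≗g (suc i)))

sumFin-toℕ : ∀ n (f : ℕ → ℕ) → sumFin n (λ i → f (toℕ i)) ≡ sumBelow n f
sumFin-toℕ zero f = refl
sumFin-toℕ (suc n) f = cong (f 0 +_) (sumFin-toℕ n (λ i → f (suc i)))

sumFin-↑ : ∀ a b (f : Fin (a + b) → ℕ) →
           sumFin (a + b) f ≡ sumFin a (λ i → f (i ↑ˡ b)) + sumFin b (λ j → f (a ↑ʳ j))
sumFin-↑ zero b f = refl
sumFin-↑ (suc a) b f = trans (cong (f zero +_) (sumFin-↑ a b (λ i → f (suc i)))) (sym (+-assoc (f zero) _ _))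

sumFin-combine : ∀ a b (f : Fin (a * b) → ℕ) →
                 sumFin (a * b) f ≡ sumFin a (λ i → sumFin b (λ j → f (combine i j)))
sumFin-combine zero b f = refl
sumFin-combine (suc a) b f = trans (sumFin-↑ b (a * b) f)
  (cong (sumFin b (λ j → f (j ↑ˡ (a * b))) +_) (sumFin-combine a b (λ i → f (b ↑ʳ i))))

sumBelow-cong : ∀ n {f g : ℕ → ℕ} → f ≗ g → sumBelow n f ≡ sumBelow n g
sumBelow-cong zero f≗g = refl
sumBelow-cong (suc n) f≗g = cong₂ _+_ (f≗g 0) (sumBelow-cong n (λ i → f≗g (suc i)))

sumBelow-+ : ∀ n (f g : ℕ → ℕ) → sumBelow n (λ i → f i + g i) ≡ sumBelow n f + sumBelow n g
sumBelow-+ zero f g = refl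
sumBelow-+ (suc n) f g = trans (cong (f 0 + g 0 +_) (sumBelow-+ n (λ i → f (suc i)) (λ i → g (suc i))))
  (interchange (f 0) (g 0) _ _)

sumBelow-0 : ∀ n → sumBelow n (λ _ → 0) ≡ 0
sumBelow-0 zero = refl
sumBelow-0 (suc n) = sumBelow-0 n

sumBelow-1 : ∀ n → sumBelow n (λ _ → 1) ≡ n
sumBelow-1 zero = refl
sumBelow-1 (suc n) = cong suc (sumBelow-1 n)

sumBelow-if : ∀ n b (f : ℕ → ℕ) → sumBelow n (λ i → if b then f i else 0) ≡ (if b then sumBelow n f else 0)
sumBelow-if n true f = refl
sumBelow-if n false f = sumBelow-0 n

sumBelow-δ : ∀ n t (f : ℕ → ℕ) →
             sumBelow n (λ i → if t ≡ᵇ i then f i else 0) ≡ (if t <ᵇ n then f t else 0)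
sumBelow-δ zero t f = refl
sumBelow-δ (suc n) zero f = trans (cong (f 0 +_) (sumBelow-0 n)) (+-identityʳ (f 0))
sumBelow-δ (suc n) (suc t) f = sumBelow-δ n t (λ i → f (suc i))

≤-sumBelow-last : ∀ n (f : ℕ → ℕ) → f n ≤ sumBelow (suc n) f
≤-sumBelow-last zero f = m≤m+n (f 0) 0
≤-sumBelow-last (suc n) f = ≤-trans (≤-sumBelow-last n (λ i → f (suc i))) (m≤n+m _ (f 0))

<ᵇ-true : ∀ {p n} → p < n → (p <ᵇ n) ≡ true
<ᵇ-true {zero} {suc n} _ = refl
<ᵇ-true {suc p} {suc n} (s≤s p<n) = <ᵇ-true p<n

≡ᵇ-comm : ∀ a b → (a ≡ᵇ b) ≡ (b ≡ᵇ a)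
≡ᵇ-comm zero zero = refl
≡ᵇ-comm zero (suc b) = refl
≡ᵇ-comm (suc a) zero = refl
≡ᵇ-comm (suc a) (suc b) = ≡ᵇ-comm a b

≡ᵇ-true⇒≡ : ∀ {a b} → (a ≡ᵇ b) ≡ true → a ≡ b
≡ᵇ-true⇒≡ {a} {b} a≡ᵇb = ≡ᵇ⇒≡ a b (subst T (sym a≡ᵇb) _)

if-∧ : ∀ a b (x : ℕ) → (if a ∧ b then x else 0) ≡ (if a then (if b then x else 0) else 0)
if-∧ true b x = refl
if-∧ false b x = refl

if-∨ : ∀ a b (x : ℕ) → (a ∧ b) ≡ false →
       (if a ∨ b then x else 0) ≡ (if a then x else 0) + (if b then x else 0)
if-∨ true false x _ = sym (+-identityʳ x)
if-∨ false b x _ = refl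

-- S_m □ P_n as a grid: row 0 is the copy of P_n over the centre of the star, rows 1, …, m the
-- copies over the leaves, and column p the copy of S_m over the p-th vertex of the path.

starAdjℕ : ℕ → ℕ → Bool
starAdjℕ s s' = ((s ≡ᵇ 0) ∧ not (s' ≡ᵇ 0)) ∨ ((s' ≡ᵇ 0) ∧ not (s ≡ᵇ 0))

pathAdjℕ : ℕ → ℕ → Bool
pathAdjℕ p p' = (p' ≡ᵇ suc p) ∨ (p ≡ᵇ suc p')

gridAdj : ℕ → ℕ → ℕ → ℕ → Bool
gridAdj s p s' p' = ((s ≡ᵇ s') ∧ pathAdjℕ p p') ∨ (starAdjℕ s s' ∧ (p ≡ᵇ p'))

before : (ℕ → ℕ) → ℕ → ℕ
before f zero = 0
before f (suc q) = f q

pathNeighbourSum : ℕ → (ℕ → ℕ) → ℕ → ℕ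
pathNeighbourSum n f p = (if suc p <ᵇ n then f (suc p) else 0) + before f p

starNeighbourSum : ℕ → ℕ → (ℕ → ℕ) → ℕ
starNeighbourSum m zero g = sumBelow m (λ i → g (suc i))
starNeighbourSum m (suc _) g = g 0

private
  pathAdj-exclusive : ∀ p p' → ((p' ≡ᵇ suc p) ∧ (p ≡ᵇ suc p')) ≡ false
  pathAdj-exclusive zero p' = ∧-zeroʳ (p' ≡ᵇ 1)
  pathAdj-exclusive (suc p) zero = refl
  pathAdj-exclusive (suc p) (suc p') = pathAdj-exclusive p p'

  gridAdj-exclusive : ∀ s p s' p' →
                      (((s ≡ᵇ s') ∧ pathAdjℕ p p') ∧ (starAdjℕ s s' ∧ (p ≡ᵇ p'))) ≡ false
  gridAdj-exclusive zero p zero p' = ∧-zeroʳ (pathAdjℕ p p')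
  gridAdj-exclusive zero p (suc s') p' = refl
  gridAdj-exclusive (suc s) p zero p' = refl
  gridAdj-exclusive (suc s) p (suc s') p' = ∧-zeroʳ ((s ≡ᵇ s') ∧ pathAdjℕ p p')

  if-gridAdj : ∀ s p s' p' x → (if gridAdj s p s' p' then x else 0) ≡
    (if s ≡ᵇ s' then (if suc p ≡ᵇ p' then x else 0) + (if p ≡ᵇ suc p' then x else 0) else 0)
    + (if starAdjℕ s s' then (if p ≡ᵇ p' then x else 0) else 0)
  if-gridAdj s p s' p' x =
    trans (if-∨ ((s ≡ᵇ s') ∧ pathAdjℕ p p') (starAdjℕ s s' ∧ (p ≡ᵇ p')) x (gridAdj-exclusive s p s' p'))
    (cong₂ _+_ (trans (if-∧ (s ≡ᵇ s') _ x) (cong (λ v → if s ≡ᵇ s' then v else 0) path-split))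
               (if-∧ (starAdjℕ s s') _ x))
    where
    path-split : (if pathAdjℕ p p' then x else 0)
                 ≡ (if suc p ≡ᵇ p' then x else 0) + (if p ≡ᵇ suc p' then x else 0)
    path-split = trans (if-∨ (p' ≡ᵇ suc p) (p ≡ᵇ suc p') x (pathAdj-exclusive p p'))
                       (cong (λ b → (if b then x else 0) + (if p ≡ᵇ suc p' then x else 0)) (≡ᵇ-comm p' (suc p)))

  sumBelow-pathAdj : ∀ n p (f : ℕ → ℕ) → p < n →
    sumBelow n (λ p' → (if suc p ≡ᵇ p' then f p' else 0) + (if p ≡ᵇ suc p' then f p' else 0))
    ≡ pathNeighbourSum n f p
  sumBelow-pathAdj n p f p<n = trans (sumBelow-+ n _ _) (cong₂ _+_ (sumBelow-δ n (suc p) f) (left p p<n))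
    where
    left : ∀ p → p < n → sumBelow n (λ p' → if p ≡ᵇ suc p' then f p' else 0) ≡ before f p
    left zero _ = sumBelow-0 n
    left (suc q) q<n = trans (sumBelow-δ n q f) (cong (λ b → if b then f q else 0) (<ᵇ-true (<⇒≤ q<n)))

  sumBelow-starAdj : ∀ m s (g : ℕ → ℕ) →
    sumBelow (suc m) (λ s' → if starAdjℕ s s' then g s' else 0) ≡ starNeighbourSum m s g
  sumBelow-starAdj m zero g = refl
  sumBelow-starAdj m (suc s) g = trans (cong (g 0 +_) (sumBelow-0 m)) (+-identityʳ (g 0))

sumBelow-gridAdj : ∀ m n s p (F : ℕ → ℕ → ℕ) → s < suc m → p < n →
  sumBelow (suc m) (λ s' → sumBelow n (λ p' → if gridAdj s p s' p' then F s' p' else 0))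
  ≡ pathNeighbourSum n (F s) p + starNeighbourSum m s (λ s' → F s' p)
sumBelow-gridAdj m n s p F s<m p<n = begin
    sumBelow (suc m) (λ s' → sumBelow n (λ p' → if gridAdj s p s' p' then F s' p' else 0))
  ≡⟨ sumBelow-cong (suc m) (λ s' → trans (sumBelow-cong n (λ p' → if-gridAdj s p s' p' (F s' p')))
                                         (sumBelow-+ n (sameRow s') (starColumn s'))) ⟩
    sumBelow (suc m) (λ s' → sumBelow n (sameRow s') + sumBelow n (starColumn s'))
  ≡⟨ sumBelow-+ (suc m) (λ s' → sumBelow n (sameRow s')) (λ s' → sumBelow n (starColumn s')) ⟩
    sumBelow (suc m) (λ s' → sumBelow n (sameRow s')) + sumBelow (suc m) (λ s' → sumBelow n (starColumn s'))
  ≡⟨ cong₂ _+_ (sumBelow-cong (suc m) (λ s' → sumBelow-if n (s ≡ᵇ s') (pathTerms s')))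
               (sumBelow-cong (suc m) (λ s' → trans (sumBelow-if n (starAdjℕ s s') _)
                  (cong (λ v → if starAdjℕ s s' then v else 0) (column s')))) ⟩
    sumBelow (suc m) (λ s' → if s ≡ᵇ s' then sumBelow n (pathTerms s') else 0)
    + sumBelow (suc m) (λ s' → if starAdjℕ s s' then F s' p else 0)
  ≡⟨ cong₂ _+_ (sumBelow-δ (suc m) s (λ s' → sumBelow n (pathTerms s')))
               (sumBelow-starAdj m s (λ s' → F s' p)) ⟩
    (if s <ᵇ suc m then sumBelow n (pathTerms s) else 0) + starNeighbourSum m s (λ s' → F s' p)
  ≡⟨ cong (λ b → (if b then sumBelow n (pathTerms s) else 0) + starNeighbourSum m s (λ s' → F s' p))
          (<ᵇ-true s<m) ⟩
    sumBelow n (pathTerms s) + starNeighbourSum m s (λ s' → F s' p)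
  ≡⟨ cong (_+ _) (sumBelow-pathAdj n p (F s) p<n) ⟩
    pathNeighbourSum n (F s) p + starNeighbourSum m s (λ s' → F s' p)
  ∎
  where
  open ≡-Reasoning
  pathTerms : ℕ → ℕ → ℕ
  pathTerms s' p' = (if suc p ≡ᵇ p' then F s' p' else 0) + (if p ≡ᵇ suc p' then F s' p' else 0)
  sameRow starColumn : ℕ → ℕ → ℕ
  sameRow s' p' = if s ≡ᵇ s' then pathTerms s' p' else 0
  starColumn s' p' = if starAdjℕ s s' then (if p ≡ᵇ p' then F s' p' else 0) else 0
  column : ∀ s' → sumBelow n (λ p' → if p ≡ᵇ p' then F s' p' else 0) ≡ F s' p
  column s' = trans (sumBelow-δ n p (F s')) (cong (λ b → if b then F s' p else 0) (<ᵇ-true p<n))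

length-filter : ∀ {A : Set} (P : A → Bool) xs →
                length (filter (λ y → P y ≟ᵇ true) xs) ≡ sum (map (λ y → if P y then 1 else 0) xs)
length-filter P [] = refl
length-filter P (y ∷ xs) with P y
... | true = cong suc (length-filter P xs)
... | false = length-filter P xs

eqℕ-≡ᵇ : ∀ a b → eqℕ a b ≡ (a ≡ᵇ b)
eqℕ-≡ᵇ a b = trans (⌊⌋-map′ _ _ (T? (a ≡ᵇ b))) (isYes-T? (a ≡ᵇ b))
  where
  isYes-T? : ∀ b → ⌊ T? b ⌋ ≡ b
  isYes-T? true = refl
  isYes-T? false = refl

eqFin-toℕ : ∀ {k} (a b : Fin k) → eqFin a b ≡ (toℕ a ≡ᵇ toℕ b)
eqFin-toℕ zero zero = refl
eqFin-toℕ zero (suc b) = refl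
eqFin-toℕ (suc a) zero = refl
eqFin-toℕ (suc a) (suc b) = trans (⌊⌋-map′ _ _ (a ≟ᶠ b)) (eqFin-toℕ a b)

module Grid (m n : ℕ) where

  row col : Fin (suc m * n) → ℕ
  row x = toℕ (proj₁ (remQuot {suc m} n x))
  col x = toℕ (proj₂ (remQuot {suc m} n x))

  row< : ∀ x → row x < suc m
  row< x = toℕ<n (proj₁ (remQuot {suc m} n x))

  col< : ∀ x → col x < n
  col< x = toℕ<n (proj₂ (remQuot {suc m} n x))

  row-combine : ∀ i j → row (combine i j) ≡ toℕ i
  row-combine i j = cong (λ ij → toℕ (proj₁ ij)) (remQuot-combine i j)

  col-combine : ∀ i j → col (combine i j) ≡ toℕ j
  col-combine i j = cong (λ ij → toℕ (proj₂ ij)) (remQuot-combine i j)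

  row-col-injective : ∀ x y → row x ≡ row y → col x ≡ col y → x ≡ y
  row-col-injective x y r c = trans (sym (combine-remQuot {suc m} n x))
    (trans (cong₂ combine (toℕ-injective r) (toℕ-injective c)) (combine-remQuot {suc m} n y))

  adj-grid : ∀ x y → adj (Star m □ Path n) x y ≡ gridAdj (row x) (col x) (row y) (col y)
  adj-grid x y = cong₂ _∨_
    (cong₂ _∧_ (eqFin-toℕ (proj₁ (remQuot {suc m} n x)) (proj₁ (remQuot {suc m} n y)))
               (cong₂ _∨_ (eqℕ-≡ᵇ (col y) (suc (col x))) (eqℕ-≡ᵇ (col x) (suc (col y)))))
    (cong₂ _∧_ (cong₂ _∨_ (cong₂ _∧_ (eqℕ-≡ᵇ (row x) 0) (cong not (eqℕ-≡ᵇ (row y) 0)))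
                          (cong₂ _∧_ (eqℕ-≡ᵇ (row y) 0) (cong not (eqℕ-≡ᵇ (row x) 0))))
               (eqFin-toℕ (proj₂ (remQuot {suc m} n x)) (proj₂ (remQuot {suc m} n y))))

  neighbourSum : ∀ x (F : ℕ → ℕ → ℕ) →
    sum (map (λ y → if adj (Star m □ Path n) x y then F (row y) (col y) else 0) (allFin (suc m * n)))
    ≡ pathNeighbourSum n (F (row x)) (col x) + starNeighbourSum m (row x) (λ s → F s (col x))
  neighbourSum x F = begin
      sum (map term (allFin (suc m * n)))
    ≡⟨ sum-map-tabulate (suc m * n) (λ y → y) term ⟩
      sumFin (suc m * n) term
    ≡⟨ sumFin-combine (suc m) n term ⟩
      sumFin (suc m) (λ i → sumFin n (λ j → term (combine i j)))
    ≡⟨ sumFin-cong (suc m) (λ i → trans (sumFin-cong n (term-combine i)) (sumFin-toℕ n (gridTerm (toℕ i)))) ⟩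
      sumFin (suc m) (λ i → sumBelow n (gridTerm (toℕ i)))
    ≡⟨ sumFin-toℕ (suc m) (λ s → sumBelow n (gridTerm s)) ⟩
      sumBelow (suc m) (λ s → sumBelow n (gridTerm s))
    ≡⟨ sumBelow-gridAdj m n (row x) (col x) F (row< x) (col< x) ⟩
      pathNeighbourSum n (F (row x)) (col x) + starNeighbourSum m (row x) (λ s → F s (col x))
    ∎
    where
    open ≡-Reasoning
    term : Fin (suc m * n) → ℕ
    term y = if adj (Star m □ Path n) x y then F (row y) (col y) else 0
    gridTerm : ℕ → ℕ → ℕ
    gridTerm s p = if gridAdj (row x) (col x) s p then F s p else 0
    term-combine : ∀ i j → term (combine i j) ≡ gridTerm (toℕ i) (toℕ j)
    term-combine i j = cong₂ (λ b v → if b then v else 0)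
      (trans (adj-grid x (combine i j)) (cong₂ (gridAdj (row x) (col x)) (row-combine i j) (col-combine i j)))
      (cong₂ F (row-combine i j) (col-combine i j))

  degree-grid : ∀ x → degree (Star m □ Path n) x
                      ≡ pathNeighbourSum n (λ _ → 1) (col x) + starNeighbourSum m (row x) (λ _ → 1)
  degree-grid x = trans (length-filter (adj (Star m □ Path n) x) (allFin (suc m * n)))
                        (neighbourSum x (λ _ _ → 1))

module Degrees (m n : ℕ) where
  open Grid m n

  centre : ∀ p → p < n → Fin (suc m * n)
  centre p p<n = combine {suc m} zero (fromℕ< p<n)

  row-centre : ∀ p p<n → row (centre p p<n) ≡ 0
  row-centre p p<n = row-combine zero (fromℕ< p<n)

  col-centre : ∀ p p<n → col (centre p p<n) ≡ p
  col-centre p p<n = trans (col-combine zero (fromℕ< p<n)) (toℕ-fromℕ< p<n)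

  adjacent-centres : ∀ p (p<n : p < n) (1+p<n : suc p < n) →
                     adj (Star m □ Path n) (centre p p<n) (centre (suc p) 1+p<n) ≡ true
  adjacent-centres p p<n 1+p<n
    rewrite adj-grid (centre p p<n) (centre (suc p) 1+p<n)
          | row-centre p p<n | row-centre (suc p) 1+p<n | col-centre p p<n | col-centre (suc p) 1+p<n
          = gridAdj-step p
    where
    gridAdj-step : ∀ p → gridAdj 0 p 0 (suc p) ≡ true
    gridAdj-step zero = refl
    gridAdj-step (suc p) = gridAdj-step p

  degree-centre : ∀ p p<n → degree (Star m □ Path n) (centre p p<n) ≡ pathNeighbourSum n (λ _ → 1) p + m
  degree-centre p p<n = trans (degree-grid (centre p p<n))
    (trans (cong₂ (λ s c → pathNeighbourSum n (λ _ → 1) c + starNeighbourSum m s (λ _ → 1))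
                  (row-centre p p<n) (col-centre p p<n))
           (cong (pathNeighbourSum n (λ _ → 1) p +_) (sumBelow-1 m)))

  starNeighbours≤ : 1 ≤ m → ∀ s → starNeighbourSum m s (λ _ → 1) ≤ m
  starNeighbours≤ _ zero = ≤-reflexive (sumBelow-1 m)
  starNeighbours≤ 1≤m (suc s) = 1≤m

  pathNeighbours≤2 : ∀ p → pathNeighbourSum n (λ _ → 1) p ≤ 2
  pathNeighbours≤2 p = +-mono-≤ (after≤ (suc p <ᵇ n)) (before≤ p)
    where
    after≤ : ∀ b → (if b then 1 else 0) ≤ 1
    after≤ true = ≤-refl
    after≤ false = z≤n
    before≤ : ∀ p → before (λ _ → 1) p ≤ 1
    before≤ zero = z≤n
    before≤ (suc p) = ≤-refl

  degree≤ : ∀ d → (∀ p → p < n → pathNeighbourSum n (λ _ → 1) p ≤ d) → 1 ≤ m →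
            ∀ x → degree (Star m □ Path n) x ≤ d + m
  degree≤ d pathNeighbours≤ 1≤m x = subst (_≤ d + m) (sym (degree-grid x))
    (+-mono-≤ (pathNeighbours≤ (col x) (col< x)) (starNeighbours≤ 1≤m (row x)))

  interior-pathNeighbours : ∀ q → suc (suc q) < n → pathNeighbourSum n (λ _ → 1) (suc q) ≡ 2
  interior-pathNeighbours q 2+q<n = cong (λ b → (if b then 1 else 0) + 1) (<ᵇ-true 2+q<n)

  degree-interior-centre : ∀ q (1+q<n : suc q < n) → suc (suc q) < n →
                           degree (Star m □ Path n) (centre (suc q) 1+q<n) ≡ 2 + m
  degree-interior-centre q 1+q<n 2+q<n =
    trans (degree-centre (suc q) 1+q<n) (cong (_+ m) (interior-pathNeighbours q 2+q<n))

open Degrees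

maxDegree-grid : ∀ m n → 1 ≤ m → 3 ≤ n → maxDegree (Star m □ Path n) ≡ 2 + m
maxDegree-grid m n 1≤m 3≤n = maxDegree-≡ (Star m □ Path n) (2 + m)
  (degree≤ m n 2 (λ p _ → pathNeighbours≤2 m n p) 1≤m) (centre m n 1 1<n) (degree-interior-centre m n 0 1<n 3≤n)
  where
  1<n : 1 < n
  1<n = ≤-trans (s≤s (s≤s z≤n)) 3≤n

maxDegree-grid₂ : ∀ m → 1 ≤ m → maxDegree (Star m □ Path 2) ≡ 1 + m
maxDegree-grid₂ m 1≤m = maxDegree-≡ (Star m □ Path 2) (1 + m)
  (degree≤ m 2 1 pathNeighbours≤1 1≤m) (centre m 2 0 (s≤s z≤n)) (degree-centre m 2 0 (s≤s z≤n))
  where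
  pathNeighbours≤1 : ∀ p → p < 2 → pathNeighbourSum 2 (λ _ → 1) p ≤ 1
  pathNeighbours≤1 zero _ = ≤-refl
  pathNeighbours≤1 (suc zero) _ = ≤-refl
  pathNeighbours≤1 (suc (suc p)) (s≤s (s≤s ()))

data GridAdjacent : ℕ → ℕ → ℕ → ℕ → Set where
  right : ∀ s p → GridAdjacent s p s (suc p)
  left : ∀ s p → GridAdjacent s (suc p) s p
  toLeaf : ∀ i p → GridAdjacent 0 p (suc i) p
  toCentre : ∀ i p → GridAdjacent (suc i) p 0 p

private
  pathAdjacent : ∀ s p p' → pathAdjℕ p p' ≡ true → GridAdjacent s p s p'
  pathAdjacent s p p' adj with p' ≡ᵇ suc p in p'≡1+p
  ... | true rewrite ≡ᵇ-true⇒≡ {p'} {suc p} p'≡1+p = right s p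
  ... | false rewrite ≡ᵇ-true⇒≡ {p} {suc p'} adj = left s p'

gridAdjacent : ∀ s p s' p' → gridAdj s p s' p' ≡ true → GridAdjacent s p s' p'
gridAdjacent zero p zero p' adj = pathAdjacent 0 p p' (trans (sym (∨-identityʳ _)) adj)
gridAdjacent zero p (suc i) p' adj rewrite ≡ᵇ-true⇒≡ {p} {p'} adj = toLeaf i p'
gridAdjacent (suc i) p zero p' adj rewrite ≡ᵇ-true⇒≡ {p} {p'} adj = toCentre i p'
gridAdjacent (suc s) p (suc s') p' adj with s ≡ᵇ s' in s≡s'
... | true rewrite ≡ᵇ-true⇒≡ {s} {s'} s≡s' = pathAdjacent (suc s') p p' (trans (sym (∨-identityʳ _)) adj)

-- Colourings from row colourings

InRange : ℕ → ℕ → Set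
InRange a c = 1 ≤ c × c ≤ a

InRange-weaken : ∀ {a k c} → a ≤ k → InRange a c → InRange k c
InRange-weaken a≤k (1≤c , c≤a) = 1≤c , ≤-trans c≤a a≤k

pathWeight : ℕ → (ℕ → ℕ) → (ℕ → ℕ) → ℕ → ℕ
pathWeight n vc ec p = vc p + ((if suc p <ᵇ n then ec p else 0) + before ec p)

-- A proper total colouring of the ray 0, 1, 2, … with colours 1, …, a (vertex p gets vc p, edge
-- {p, p + 1} gets ec p) whose weights distinguish neighbours within its initial segment P_n.
record PathColouring (n a : ℕ) : Set where
  field
    vc ec : ℕ → ℕ
    vc-range : ∀ p → InRange a (vc p)
    ec-range : ∀ p → InRange a (ec p)
    vc-proper : ∀ p → vc p ≢ vc (suc p)
    ec-proper : ∀ p → ec p ≢ ec (suc p)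
    ec≢vc : ∀ p → ec p ≢ vc p
    ec≢vc-suc : ∀ p → ec p ≢ vc (suc p)
    weights-differ : ∀ p → suc p < n → pathWeight n vc ec p ≢ pathWeight n vc ec (suc p)

open PathColouring

record GridScheme (n a : ℕ) : Set where
  field
    centreRow leafRow : PathColouring n a
    rows-differ : ∀ p → vc centreRow p ≢ vc leafRow p
    leafWeight≤ : ∀ p → p < n → pathWeight n (vc leafRow) (ec leafRow) p
                                ≤ pathWeight n (vc centreRow) (ec centreRow) p + a

pathNeighbourSum-⊓ : ∀ n (f : ℕ → ℕ) p →
  pathNeighbourSum n (λ p' → f (p ⊓ p')) p ≡ (if suc p <ᵇ n then f p else 0) + before f p
pathNeighbourSum-⊓ n f p =
  cong₂ (λ c c' → (if suc p <ᵇ n then f c else 0) + c') (m≤n⇒m⊓n≡m (n≤1+n p)) (before-⊓ p)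
  where
  before-⊓ : ∀ p → before (λ p' → f (p ⊓ p')) p ≡ before f p
  before-⊓ zero = refl
  before-⊓ (suc q) = cong f (m≥n⇒m⊓n≡n (n≤1+n q))

module GridColouring {m n a k : ℕ} (S : GridScheme n a) (2≤m : 2 ≤ m) (m+a≤k : m + a ≤ k) where
  open GridScheme S
  open Grid m n

  rowColouring : ℕ → PathColouring n a
  rowColouring zero = centreRow
  rowColouring (suc _) = leafRow

  edgeColour : ℕ → ℕ → ℕ → ℕ → ℕ
  edgeColour zero p zero p' = ec centreRow (p ⊓ p')
  edgeColour (suc _) p (suc _) p' = ec leafRow (p ⊓ p')
  edgeColour zero _ (suc i) _ = suc i + a
  edgeColour (suc i) _ zero _ = suc i + a

  colouring : TotalColouring (Star m □ Path n)
  colouring = record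
    { vcol = λ x → vc (rowColouring (row x)) (col x)
    ; ecol = λ x y → edgeColour (row x) (col x) (row y) (col y) }

  starSum : ℕ
  starSum = sumBelow m (λ i → suc i + a)

  starPart : ℕ → ℕ
  starPart zero = starSum
  starPart (suc i) = suc i + a

  gridWeight : ℕ → ℕ → ℕ
  gridWeight s p = pathWeight n (vc (rowColouring s)) (ec (rowColouring s)) p + starPart s

  pathEdge : ∀ s p p' → edgeColour s p s p' ≡ ec (rowColouring s) (p ⊓ p')
  pathEdge zero p p' = refl
  pathEdge (suc s) p p' = refl

  rightEdge : ∀ s p → edgeColour s p s (suc p) ≡ ec (rowColouring s) p
  rightEdge s p = trans (pathEdge s p (suc p)) (cong (ec (rowColouring s)) (m≤n⇒m⊓n≡m (n≤1+n p)))

  leftEdge : ∀ s q → edgeColour s (suc q) s q ≡ ec (rowColouring s) q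
  leftEdge s q = trans (pathEdge s (suc q) q) (cong (ec (rowColouring s)) (m≥n⇒m⊓n≡n (n≤1+n q)))

  weight-colouring : ∀ x → weight (Star m □ Path n) colouring x ≡ gridWeight (row x) (col x)
  weight-colouring x = trans (cong (vc (rowColouring (row x)) (col x) +_) (neighbourSum x (edgeColour (row x) (col x))))
                             (gridWeight-≡ (row x) (col x))
    where
    rearranged : ∀ s p → vc (rowColouring s) p + (pathNeighbourSum n (λ p' → ec (rowColouring s) (p ⊓ p')) p
                                                 + starPart s)
                         ≡ gridWeight s p
    rearranged s p = trans
      (cong (λ w → vc (rowColouring s) p + (w + starPart s)) (pathNeighbourSum-⊓ n (ec (rowColouring s)) p))
      (sym (+-assoc (vc (rowColouring s) p) _ (starPart s)))
    gridWeight-≡ : ∀ s p → vc (rowColouring s) p + (pathNeighbourSum n (edgeColour s p s) p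
                                                   + starNeighbourSum m s (λ s' → edgeColour s p s' p))
                           ≡ gridWeight s p
    gridWeight-≡ zero p = rearranged 0 p
    gridWeight-≡ (suc i) p = rearranged (suc i) p

  private
    a≤k : a ≤ k
    a≤k = ≤-trans (m≤n+m a m) m+a≤k

    ≢-star : ∀ {c} i → c ≤ a → c ≢ suc i + a
    ≢-star i c≤a c≡ = <⇒≱ (m<n+m a {suc i} (s≤s z≤n)) (subst (_≤ a) c≡ c≤a)

    ec≢star : ∀ s p i → ec (rowColouring s) p ≢ suc i + a
    ec≢star s p i = ≢-star i (proj₂ (ec-range (rowColouring s) p))

  vertex-range : ∀ s p → InRange k (vc (rowColouring s) p)
  vertex-range s p = InRange-weaken a≤k (vc-range (rowColouring s) p)

  edge-range : ∀ {s p s' p'} → GridAdjacent s p s' p' → s < suc m → s' < suc m → InRange k (edgeColour s p s' p')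
  edge-range (right s p) _ _ = subst (InRange k) (sym (rightEdge s p)) (InRange-weaken a≤k (ec-range (rowColouring s) p))
  edge-range (left s q) _ _ = subst (InRange k) (sym (leftEdge s q)) (InRange-weaken a≤k (ec-range (rowColouring s) q))
  edge-range (toLeaf i p) _ 1+i<1+m = s≤s z≤n , ≤-trans (+-monoˡ-≤ a (s≤s⁻¹ 1+i<1+m)) m+a≤k
  edge-range (toCentre i p) 1+i<1+m _ = s≤s z≤n , ≤-trans (+-monoˡ-≤ a (s≤s⁻¹ 1+i<1+m)) m+a≤k

  edgeColour-sym : ∀ s p s' p' → edgeColour s p s' p' ≡ edgeColour s' p' s p
  edgeColour-sym zero p zero p' = cong (ec centreRow) (⊓-comm p p')
  edgeColour-sym zero p (suc s') p' = refl
  edgeColour-sym (suc s) p zero p' = refl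
  edgeColour-sym (suc s) p (suc s') p' = cong (ec leafRow) (⊓-comm p p')

  vertices-proper : ∀ {s p s' p'} → GridAdjacent s p s' p' → vc (rowColouring s) p ≢ vc (rowColouring s') p'
  vertices-proper (right s p) = vc-proper (rowColouring s) p
  vertices-proper (left s q) = ≢-sym (vc-proper (rowColouring s) q)
  vertices-proper (toLeaf i p) = rows-differ p
  vertices-proper (toCentre i p) = ≢-sym (rows-differ p)

  edge≢vertex : ∀ {s p s' p'} → GridAdjacent s p s' p' → edgeColour s p s' p' ≢ vc (rowColouring s) p
  edge≢vertex (right s p) rewrite rightEdge s p = ec≢vc (rowColouring s) p
  edge≢vertex (left s q) rewrite leftEdge s q = ec≢vc-suc (rowColouring s) q
  edge≢vertex (toLeaf i p) = ≢-sym (≢-star i (proj₂ (vc-range centreRow p)))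
  edge≢vertex (toCentre i p) = ≢-sym (≢-star i (proj₂ (vc-range leafRow p)))

  edges-proper : ∀ {s p s₁ p₁ s₂ p₂} → GridAdjacent s p s₁ p₁ → GridAdjacent s p s₂ p₂ →
                 (s₁ ≡ s₂ → p₁ ≡ p₂ → ⊥) → edgeColour s p s₁ p₁ ≢ edgeColour s p s₂ p₂
  edges-proper (right s p) (right s p) distinct = ⊥-elim (distinct refl refl)
  edges-proper (right s (suc q)) (left s q) _ rewrite rightEdge s (suc q) | leftEdge s q =
    ≢-sym (ec-proper (rowColouring s) q)
  edges-proper (left s q) (right s (suc q)) _ rewrite rightEdge s (suc q) | leftEdge s q =
    ec-proper (rowColouring s) q
  edges-proper (left s q) (left s q) distinct = ⊥-elim (distinct refl refl)
  edges-proper (right 0 p) (toLeaf i p) _ rewrite rightEdge 0 p = ec≢star 0 p i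
  edges-proper (toLeaf i p) (right 0 p) _ rewrite rightEdge 0 p = ≢-sym (ec≢star 0 p i)
  edges-proper (left 0 q) (toLeaf i (suc q)) _ rewrite leftEdge 0 q = ec≢star 0 q i
  edges-proper (toLeaf i (suc q)) (left 0 q) _ rewrite leftEdge 0 q = ≢-sym (ec≢star 0 q i)
  edges-proper (toLeaf i p) (toLeaf j p) distinct i+a≡j+a =
    distinct (+-cancelʳ-≡ a (suc i) (suc j) i+a≡j+a) refl
  edges-proper (right (suc s) p) (toCentre s p) _ rewrite rightEdge 1 p = ec≢star 1 p s
  edges-proper (toCentre s p) (right (suc s) p) _ rewrite rightEdge 1 p = ≢-sym (ec≢star 1 p s)
  edges-proper (left (suc s) q) (toCentre s (suc q)) _ rewrite leftEdge 1 q = ec≢star 1 q s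
  edges-proper (toCentre s (suc q)) (left (suc s) q) _ rewrite leftEdge 1 q = ≢-sym (ec≢star 1 q s)
  edges-proper (toCentre i p) (toCentre i p) distinct = ⊥-elim (distinct refl refl)

  -- A leaf row weight exceeds the centre row weight by at most a, and the star edges at a centre
  -- vertex contribute at least (a + 1) + (a + m), at a leaf vertex at most a + m.
  centre-heavier : ∀ i p → suc i ≤ m → p < n → gridWeight (suc i) p < gridWeight 0 p
  centre-heavier i p 1+i≤m p<n = begin-strict
      pathWeight n (vc leafRow) (ec leafRow) p + (suc i + a)
    ≤⟨ +-mono-≤ (leafWeight≤ p p<n) (+-monoˡ-≤ a 1+i≤m) ⟩
      (centreWeight + a) + (m + a)
    <⟨ n<1+n _ ⟩
      suc (centreWeight + a + (m + a))
    ≡⟨ trans (cong suc (+-assoc centreWeight a (m + a))) (sym (+-suc centreWeight (a + (m + a)))) ⟩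
      centreWeight + (suc a + (m + a))
    ≤⟨ +-monoʳ-≤ centreWeight (starSum≥ m 2≤m) ⟩
      centreWeight + starSum
    ∎
    where
    open ≤-Reasoning
    centreWeight : ℕ
    centreWeight = pathWeight n (vc centreRow) (ec centreRow) p
    starSum≥ : ∀ j → 2 ≤ j → suc a + (j + a) ≤ sumBelow j (λ i → suc i + a)
    starSum≥ (suc (suc j)) _ = +-monoʳ-≤ (suc a) (≤-sumBelow-last j (λ i → suc (suc i) + a))
    starSum≥ (suc zero) (s≤s ())

  weights-differ-grid : ∀ {s p s' p'} → GridAdjacent s p s' p' → s < suc m → s' < suc m → p < n → p' < n →
                        gridWeight s p ≢ gridWeight s' p'
  weights-differ-grid (right s p) _ _ _ 1+p<n eq =
    weights-differ (rowColouring s) p 1+p<n (+-cancelʳ-≡ (starPart s) _ _ eq)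
  weights-differ-grid (left s q) _ _ 1+q<n _ eq =
    weights-differ (rowColouring s) q 1+q<n (sym (+-cancelʳ-≡ (starPart s) _ _ eq))
  weights-differ-grid (toLeaf i p) _ 1+i<1+m p<n _ = ≢-sym (<⇒≢ (centre-heavier i p (s≤s⁻¹ 1+i<1+m) p<n))
  weights-differ-grid (toCentre i p) 1+i<1+m _ p<n _ = <⇒≢ (centre-heavier i p (s≤s⁻¹ 1+i<1+m) p<n)

  isNSDTotalColouring : IsNSDTotalColouring (Star m □ Path n) k colouring
  isNSDTotalColouring =
      (λ x → vertex-range (row x) (col x))
    , (λ x y x~y → edge-range (view x~y) (row< x) (row< y))
    , (λ x y _ → edgeColour-sym (row x) (col x) (row y) (col y))
    , (λ x y x~y → vertices-proper (view x~y))
    , (λ x y z x~y x~z y≢z → edges-proper (view x~y) (view x~z) (λ r c → y≢z (row-col-injective y z r c)))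
    , (λ x y x~y → edge≢vertex (view x~y))
    , (λ x y x~y w≡w → weights-differ-grid (view x~y) (row< x) (row< y) (col< x) (col< y)
                         (trans (sym (weight-colouring x)) (trans w≡w (weight-colouring y))))
    where
    view : ∀ {x y} → adj (Star m □ Path n) x y ≡ true → GridAdjacent (row x) (col x) (row y) (col y)
    view {x} {y} x~y = gridAdjacent _ _ _ _ (trans (sym (adj-grid x y)) x~y)

gridColouring : ∀ {m n a k} → GridScheme n a → 2 ≤ m → m + a ≤ k → HasNSDTotalColouring (Star m □ Path n) k
gridColouring S 2≤m m+a≤k = colouring , isNSDTotalColouring
  where open GridColouring S 2≤m m+a≤k

-- Periodic row colourings

cycle₂ : ℕ → ℕ → ℕ → ℕ
cycle₂ x y zero = x
cycle₂ x y (suc zero) = y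
cycle₂ x y (suc (suc p)) = cycle₂ x y p

cycle₃ : ℕ → ℕ → ℕ → ℕ → ℕ
cycle₃ x y z zero = x
cycle₃ x y z (suc zero) = y
cycle₃ x y z (suc (suc zero)) = z
cycle₃ x y z (suc (suc (suc p))) = cycle₃ x y z p

∀-by-period₂ : ∀ {P : ℕ → Set} → P 0 → P 1 → (∀ {p} → P p → P (2 + p)) → ∀ p → P p
∀-by-period₂ {P} P0 P1 step zero = P0
∀-by-period₂ {P} P0 P1 step (suc zero) = P1
∀-by-period₂ {P} P0 P1 step (suc (suc p)) = step (∀-by-period₂ {P} P0 P1 step p)

∀-by-period₃ : ∀ {P : ℕ → Set} → P 0 → P 1 → P 2 → (∀ {p} → P p → P (3 + p)) → ∀ p → P p
∀-by-period₃ {P} P0 P1 P2 step zero = P0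
∀-by-period₃ {P} P0 P1 P2 step (suc zero) = P1
∀-by-period₃ {P} P0 P1 P2 step (suc (suc zero)) = P2
∀-by-period₃ {P} P0 P1 P2 step (suc (suc (suc p))) = step (∀-by-period₃ {P} P0 P1 P2 step p)

≤-by-decision : ∀ {a b} {_ : True (a ≤? b)} → a ≤ b
≤-by-decision {a} {b} {a≤b} = toWitness a≤b

inRange : ∀ {a c} {_ : True (1 ≤? c)} {_ : True (c ≤? a)} → InRange a c
inRange {a} {c} {1≤c} {c≤a} = toWitness 1≤c , toWitness c≤a

pathWeights-differ : ∀ n (vc ec : ℕ → ℕ) → 3 ≤ n →
  vc 0 + (ec 0 + 0) ≢ vc 1 + (ec 1 + ec 0) →
  (∀ q → vc (1 + q) + (ec (1 + q) + ec q) ≢ vc (2 + q) + (ec (2 + q) + ec (1 + q))) →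
  (∀ q → vc (1 + q) + (ec (1 + q) + ec q) ≢ vc (2 + q) + (0 + ec (1 + q))) →
  ∀ p → suc p < n → pathWeight n vc ec p ≢ pathWeight n vc ec (suc p)
pathWeights-differ n vc ec 3≤n first interior last zero 1<n
  rewrite <ᵇ-true 1<n | <ᵇ-true 3≤n = first
pathWeights-differ n vc ec 3≤n first interior last (suc q) 2+q<n
  rewrite <ᵇ-true 2+q<n with 3 + q <ᵇ n
... | true = interior q
... | false = last q

module _ (n : ℕ) where

  centreRow₃ : (∀ p → suc p < n → pathWeight n (cycle₃ 1 3 2) (cycle₃ 2 1 3) p
                                ≢ pathWeight n (cycle₃ 1 3 2) (cycle₃ 2 1 3) (suc p)) → PathColouring n 3
  centreRow₃ weights-differ = record
    { vc = cycle₃ 1 3 2 ; ec = cycle₃ 2 1 3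
    ; vc-range = ∀-by-period₃ inRange inRange inRange id
    ; ec-range = ∀-by-period₃ inRange inRange inRange id
    ; vc-proper = ∀-by-period₃ (λ ()) (λ ()) (λ ()) id
    ; ec-proper = ∀-by-period₃ (λ ()) (λ ()) (λ ()) id
    ; ec≢vc = ∀-by-period₃ (λ ()) (λ ()) (λ ()) id
    ; ec≢vc-suc = ∀-by-period₃ (λ ()) (λ ()) (λ ()) id
    ; weights-differ = weights-differ }

  leafRow₃ : (∀ p → suc p < n → pathWeight n (cycle₃ 2 1 3) (cycle₃ 3 2 1) p
                              ≢ pathWeight n (cycle₃ 2 1 3) (cycle₃ 3 2 1) (suc p)) → PathColouring n 3
  leafRow₃ weights-differ = record
    { vc = cycle₃ 2 1 3 ; ec = cycle₃ 3 2 1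
    ; vc-range = ∀-by-period₃ inRange inRange inRange id
    ; ec-range = ∀-by-period₃ inRange inRange inRange id
    ; vc-proper = ∀-by-period₃ (λ ()) (λ ()) (λ ()) id
    ; ec-proper = ∀-by-period₃ (λ ()) (λ ()) (λ ()) id
    ; ec≢vc = ∀-by-period₃ (λ ()) (λ ()) (λ ()) id
    ; ec≢vc-suc = ∀-by-period₃ (λ ()) (λ ()) (λ ()) id
    ; weights-differ = weights-differ }

  rows₃-differ : ∀ p → cycle₃ 1 3 2 p ≢ cycle₃ 2 1 3 p
  rows₃-differ = ∀-by-period₃ (λ ()) (λ ()) (λ ()) id

scheme₂ : GridScheme 2 3
scheme₂ = record
  { centreRow = centreRow₃ 2 (λ { zero _ → λ () ; (suc p) (s≤s (s≤s ())) })
  ; leafRow = leafRow₃ 2 (λ { zero _ → λ () ; (suc p) (s≤s (s≤s ())) })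
  ; rows-differ = rows₃-differ 2
  ; leafWeight≤ = λ { zero _ → ≤-by-decision ; (suc zero) _ → ≤-by-decision
                    ; (suc (suc p)) (s≤s (s≤s ())) } }

scheme₃ : GridScheme 3 3
scheme₃ = record
  { centreRow = centreRow₃ 3 (λ { zero _ → λ () ; (suc zero) _ → λ () ; (suc (suc p)) (s≤s (s≤s (s≤s ()))) })
  ; leafRow = leafRow₃ 3 (λ { zero _ → λ () ; (suc zero) _ → λ () ; (suc (suc p)) (s≤s (s≤s (s≤s ()))) })
  ; rows-differ = rows₃-differ 3
  ; leafWeight≤ = λ { zero _ → ≤-by-decision ; (suc zero) _ → ≤-by-decision
                    ; (suc (suc zero)) _ → ≤-by-decision
                    ; (suc (suc (suc p))) (s≤s (s≤s (s≤s ()))) } }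

scheme₄ : ∀ n → 4 ≤ n → GridScheme n 4
scheme₄ n 4≤n = record
  { centreRow = record
    { vc = cycle₂ 1 3 ; ec = cycle₂ 2 4
    ; vc-range = ∀-by-period₂ inRange inRange id
    ; ec-range = ∀-by-period₂ inRange inRange id
    ; vc-proper = ∀-by-period₂ (λ ()) (λ ()) id
    ; ec-proper = ∀-by-period₂ (λ ()) (λ ()) id
    ; ec≢vc = ∀-by-period₂ (λ ()) (λ ()) id
    ; ec≢vc-suc = ∀-by-period₂ (λ ()) (λ ()) id
    ; weights-differ = pathWeights-differ n (cycle₂ 1 3) (cycle₂ 2 4) 3≤n (λ ())
        (∀-by-period₂ (λ ()) (λ ()) id) (∀-by-period₂ (λ ()) (λ ()) id) }
  ; leafRow = record
    { vc = cycle₂ 2 1 ; ec = cycle₂ 3 4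
    ; vc-range = ∀-by-period₂ inRange inRange id
    ; ec-range = ∀-by-period₂ inRange inRange id
    ; vc-proper = ∀-by-period₂ (λ ()) (λ ()) id
    ; ec-proper = ∀-by-period₂ (λ ()) (λ ()) id
    ; ec≢vc = ∀-by-period₂ (λ ()) (λ ()) id
    ; ec≢vc-suc = ∀-by-period₂ (λ ()) (λ ()) id
    ; weights-differ = pathWeights-differ n (cycle₂ 2 1) (cycle₂ 3 4) 3≤n (λ ())
        (∀-by-period₂ (λ ()) (λ ()) id) (∀-by-period₂ (λ ()) (λ ()) id) }
  ; rows-differ = ∀-by-period₂ (λ ()) (λ ()) id
  ; leafWeight≤ = leafWeight≤ }
  where
  3≤n : 3 ≤ n
  3≤n = ≤-trans (n≤1+n 3) 4≤n
  leafWeight≤ : ∀ p → p < n →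
                pathWeight n (cycle₂ 2 1) (cycle₂ 3 4) p ≤ pathWeight n (cycle₂ 1 3) (cycle₂ 2 4) p + 4
  leafWeight≤ zero _ = first (1 <ᵇ n)
    where
    first : ∀ b → 2 + ((if b then 3 else 0) + 0) ≤ 1 + ((if b then 2 else 0) + 0) + 4
    first true = ≤-by-decision
    first false = ≤-by-decision
  leafWeight≤ (suc q) _ = later (suc (suc q) <ᵇ n) q
    where
    later : ∀ b q → cycle₂ 2 1 (suc q) + ((if b then cycle₂ 3 4 (suc q) else 0) + cycle₂ 3 4 q)
                    ≤ cycle₂ 1 3 (suc q) + ((if b then cycle₂ 2 4 (suc q) else 0) + cycle₂ 2 4 q) + 4
    later true = ∀-by-period₂ ≤-by-decision ≤-by-decision id
    later false = ∀-by-period₂ ≤-by-decision ≤-by-decision id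

private
  <+1⇒≤ : ∀ {j d} → j < d + 1 → j ≤ d
  <+1⇒≤ {j} {d} j<d+1 = m<1+n⇒m≤n (subst (j <_) (+-comm d 1) j<d+1)

  <+2⇒≤1+ : ∀ {j d} → j < d + 2 → j ≤ suc d
  <+2⇒≤1+ {j} {d} j<d+2 = m<1+n⇒m≤n (subst (j <_) (+-comm d 2) j<d+2)

χ-S□P₃ : ∀ m → 2 ≤ m → NSDTotalChromaticNumberIs (Star m □ Path 3) (maxDegree (Star m □ Path 3) + 1)
χ-S□P₃ m 2≤m rewrite maxDegree-grid m 3 (<⇒≤ 2≤m) ≤-refl =
    gridColouring scheme₃ 2≤m (≤-reflexive (trans (+-comm m 3) (+-comm 1 (2 + m))))
  , λ j j<k → no-colouring-≤-degree (Star m □ Path 3) (centre m 3 1 1<3) j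
                (subst (j ≤_) (sym (degree-interior-centre m 3 0 1<3 ≤-refl)) (<+1⇒≤ j<k))
  where
  1<3 : 1 < 3
  1<3 = s≤s (s≤s z≤n)

χ-S□P₂ : ∀ m → 2 ≤ m → NSDTotalChromaticNumberIs (Star m □ Path 2) (maxDegree (Star m □ Path 2) + 2)
χ-S□P₂ m 2≤m rewrite maxDegree-grid₂ m (<⇒≤ 2≤m) =
    gridColouring scheme₂ 2≤m (≤-reflexive (trans (+-comm m 3) (+-comm 2 (1 + m))))
  , λ j j<k → no-colouring-≤-suc-degree (Star m □ Path 2) (centre m 2 0 0<2) (centre m 2 1 1<2)
                (adjacent-centres m 2 0 0<2 1<2)
                (trans (degree-centre m 2 0 0<2) (sym (degree-centre m 2 1 1<2))) j
                (subst (λ d → j ≤ suc d) (sym (degree-centre m 2 0 0<2)) (<+2⇒≤1+ j<k))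
  where
  0<2 : 0 < 2
  0<2 = s≤s z≤n
  1<2 : 1 < 2
  1<2 = s≤s (s≤s z≤n)

χ-S□P≥4 : ∀ m n → 2 ≤ m → 4 ≤ n →
          NSDTotalChromaticNumberIs (Star m □ Path n) (maxDegree (Star m □ Path n) + 2)
χ-S□P≥4 m n 2≤m 4≤n rewrite maxDegree-grid m n (<⇒≤ 2≤m) (≤-trans (n≤1+n 3) 4≤n) =
    gridColouring (scheme₄ n 4≤n) 2≤m (≤-reflexive (trans (+-comm m 4) (+-comm 2 (2 + m))))
  , λ j j<k → no-colouring-≤-suc-degree (Star m □ Path n) (centre m n 1 1<n) (centre m n 2 3≤n)
                (adjacent-centres m n 1 1<n 3≤n)
                (trans (degree-interior-centre m n 0 1<n 3≤n) (sym (degree-interior-centre m n 1 3≤n 4≤n))) j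
                (subst (λ d → j ≤ suc d) (sym (degree-interior-centre m n 0 1<n 3≤n)) (<+2⇒≤1+ j<k))
  where
  3≤n : 3 ≤ n
  3≤n = ≤-trans (n≤1+n 3) 4≤n
  1<n : 1 < n
  1<n = ≤-trans (s≤s (s≤s z≤n)) 3≤n

theorem4p3 : ∀ (m n : ℕ) → 2 ≤ m → 2 ≤ n →
    (n ≡ 3 → NSDTotalChromaticNumberIs (Star m □ Path n) (maxDegree (Star m □ Path n) + 1))
    × (n ≢ 3 → NSDTotalChromaticNumberIs (Star m □ Path n) (maxDegree (Star m □ Path n) + 2))
theorem4p3 m n 2≤m 2≤n = (λ { refl → χ-S□P₃ m 2≤m }) , n≢3-case n 2≤n
  where
  n≢3-case : ∀ n → 2 ≤ n → n ≢ 3 →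
             NSDTotalChromaticNumberIs (Star m □ Path n) (maxDegree (Star m □ Path n) + 2)
  n≢3-case 0 () _
  n≢3-case 1 (s≤s ()) _
  n≢3-case 2 _ _ = χ-S□P₂ m 2≤m
  n≢3-case 3 _ n≢3 = ⊥-elim (n≢3 refl)
  n≢3-case (suc (suc (suc (suc n)))) _ _ = χ-S□P≥4 m (4 + n) 2≤m (s≤s (s≤s (s≤s (s≤s z≤n))))
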